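{- Let $G$ be a finite connected simple graph with $n$ vertices and $m$ edges, and let $k\ge 1$ be an integer. Then \[\Pi_1(R_k(G))=4^{km}(k+1)^{2n}\,\Pi_1(G).\]
   Context: For a graph $H$ and vertex $v$, $d_H(v)$ denotes the degree of $v$ in $H$. Define $\Pi_1(H)=\prod_{v\in V(H)} d_H(v)^2$. The $k$-th semi total point graph $R_k(G)$ is obtained from $G$ by adding, for each edge $uv$ of $G$, $k$ new vertices (distinct for distinct edges) and joining each of them to both $u$ and $v$ (the edges of $G$ are kept). -}

module Defs where

open import Data.Nat using (ℕ; _+_; _*_; _^_)
open import Data.Fin using (Fin; _↑ˡ_; _↑ʳ_; combine; _≟_)
open import Data.List using (List; []; _∷_; _++_; map; concatMap; length; lookup; filter; allFin)
open import Data.Nat.ListAction using (product)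
open import Data.List.Relation.Unary.All using (All)
open import Data.List.Relation.Unary.AllPairs using (AllPairs)
open import Data.List.Membership.Propositional using (_∈_)
open import Data.Product using (_×_; _,_; proj₁; proj₂)
open import Data.Sum using (_⊎_)
open import Relation.Nullary using (¬_; Dec)
open import Relation.Nullary.Decidable using (_⊎-dec_)
open import Relation.Binary.PropositionalEquality using (_≡_; _≢_)

-- A graph on vertex set Fin n is given by its list of edges (each edge an
-- unordered pair, stored as an ordered pair in some orientation).
Edge : ℕ → Set
Edge n = Fin n × Fin n

EdgeList : ℕ → Set
EdgeList n = List (Edge n)

SameEdge : ∀ {n} → Edge n → Edge n → Set
SameEdge (a , b) (c , d) = (a ≡ c × b ≡ d) ⊎ (a ≡ d × b ≡ c)

IsSimple : ∀ {n} → EdgeList n → Set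
IsSimple E = All (λ { (a , b) → a ≢ b }) E × AllPairs (λ e f → ¬ SameEdge e f) E

data Reachable {n} (E : EdgeList n) : Fin n → Fin n → Set where
  here  : ∀ {u} → Reachable E u u
  fwd   : ∀ {u v w} → (u , v) ∈ E → Reachable E v w → Reachable E u w
  bwd   : ∀ {u v w} → (v , u) ∈ E → Reachable E v w → Reachable E u w

IsConnected : ∀ {n} → EdgeList n → Set
IsConnected {n} E = (u v : Fin n) → Reachable E u v

incident? : ∀ {n} (v : Fin n) (e : Edge n) → Dec (proj₁ e ≡ v ⊎ proj₂ e ≡ v)
incident? v (a , b) = (a ≟ v) ⊎-dec (b ≟ v)

degree : ∀ {n} → EdgeList n → Fin n → ℕ
degree E v = length (filter (incident? v) E)

Π₁ : ∀ {n} → EdgeList n → ℕ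
Π₁ {n} E = product (map (λ v → degree E v ^ 2) (allFin n))

-- k-th semi total point graph R_k(G).
-- Vertices: Fin (n + m * k); old vertex v ↦ v ↑ˡ (m * k);
-- the j-th new vertex of edge number e ↦ n ↑ʳ combine e j.
Rk : ∀ {n} (k : ℕ) (E : EdgeList n) → EdgeList (n + length E * k)
Rk {n} k E =
  map (λ { (a , b) → (a ↑ˡ (length E * k) , b ↑ˡ (length E * k)) }) E
  ++ concatMap (λ e → concatMap (λ j → newEdges (lookup E e) (n ↑ʳ combine e j)) (allFin k))
               (allFin (length E))
  where
  newEdges : Edge n → Fin (n + length E * k) → EdgeList (n + length E * k)
  newEdges (u , v) w = (u ↑ˡ (length E * k) , w) ∷ (v ↑ˡ (length E * k) , w) ∷ []

-- In R_k(G) an original vertex x keeps its d(x) edges and gains one edge to each of the k new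
-- vertices of every edge at x, so its degree is (k+1) d(x); each new vertex has degree 2.
-- Squaring and multiplying gives (k+1)^(2n) Π₁(G) · 4^(km).
module Submission where

open import Defs
open import Data.Nat using (ℕ; zero; suc; _+_; _*_; _^_; _≥_)
open import Data.Nat.Properties using (+-comm; +-identityʳ; *-comm; *-assoc; *-zeroʳ; *-distribˡ-+; ^-*-assoc; *-commutativeSemigroup)
open import Data.Nat.ListAction using (sum; product)
open import Data.Nat.ListAction.Properties using (product-++)
open import Data.Bool using (true; false)
open import Algebra.Properties.CommutativeSemigroup *-commutativeSemigroup using () renaming (interchange to *-interchange)
import Data.Fin as Fin
open import Data.Fin using (Fin; _↑ˡ_; _↑ʳ_; combine; remQuot; splitAt; _≟_)
open import Data.Fin.Properties using (↑ˡ-injective; ↑ʳ-injective; splitAt-↑ˡ; splitAt-↑ʳ; combine-injectiveˡ; combine-injectiveʳ; combine-remQuot; suc-injective)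
open import Data.List using (List; []; _∷_; _++_; map; concatMap; length; lookup; filter; tabulate; allFin)
open import Data.List.Properties using (length-++; filter-++; filter-≐; map-tabulate; tabulate-lookup; length-tabulate; concatMap-pure; map-cong; map-cong-local; map-∘)
open import Data.List.Relation.Unary.All as All using (All)
open import Data.Product using (_,_; proj₁; proj₂)
open import Data.Sum using (inj₁; inj₂; [_,_]′)
import Data.Sum as Sum
open import Function using (_∘_; id; case_of_)
open import Relation.Nullary using (¬_; yes; no; does; contradiction)
open import Relation.Unary using (Pred; Decidable; _≐_)
open import Relation.Binary.PropositionalEquality using (_≡_; _≢_; refl; sym; trans; cong; cong₂; module ≡-Reasoning)

count : ∀ {a p} {A : Set a} {P : Pred A p} → Decidable P → List A → ℕ
count P? = length ∘ filter P?

module _ {a p} {A : Set a} {P : Pred A p} (P? : Decidable P) where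

  count-++ : ∀ xs ys → count P? (xs ++ ys) ≡ count P? xs + count P? ys
  count-++ xs ys = trans (cong length (filter-++ P? xs ys)) (length-++ (filter P? xs))

  count-concatMap : ∀ {b} {B : Set b} (f : B → List A) xs → count P? (concatMap f xs) ≡ sum (map (count P? ∘ f) xs)
  count-concatMap f []       = refl
  count-concatMap f (x ∷ xs) = trans (count-++ (f x) _) (cong (count P? (f x) +_) (count-concatMap f xs))

  count-singletons : ∀ xs → count P? xs ≡ sum (map (λ x → count P? (x ∷ [])) xs)
  count-singletons xs = trans (cong (count P?) (sym (concatMap-pure xs))) (count-concatMap {B = A} (_∷ []) xs)

  count-map : ∀ {b} {B : Set b} (f : B → A) xs → count P? (map f xs) ≡ count (P? ∘ f) xs
  count-map f []       = refl
  count-map f (x ∷ xs) with does (P? (f x))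
  ... | true  = cong suc (count-map f xs)
  ... | false = count-map f xs

  count-none : (∀ x → ¬ P x) → ∀ xs → count P? xs ≡ 0
  count-none ¬P []       = refl
  count-none ¬P (x ∷ xs) with P? x
  ... | yes px = case ¬P x px of λ ()
  ... | no _   = count-none ¬P xs

  count-≐ : ∀ {q} {Q : Pred A q} (Q? : Decidable Q) → P ≐ Q → ∀ xs → count P? xs ≡ count Q? xs
  count-≐ Q? P≐Q xs = cong length (filter-≐ P? Q? P≐Q xs)

allFin-suc : ∀ n → allFin (suc n) ≡ Fin.zero ∷ map Fin.suc (allFin n)
allFin-suc n = cong (Fin.zero ∷_) (sym (map-tabulate id Fin.suc))

count-≟-allFin : ∀ {n} (i : Fin n) → count (_≟ i) (allFin n) ≡ 1
count-≟-allFin {suc n} i@Fin.zero = begin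
  count (_≟ i) (allFin (suc n))                    ≡⟨ cong (count (_≟ i)) (allFin-suc n) ⟩
  suc (count (_≟ i) (map Fin.suc (allFin n)))      ≡⟨ cong suc (count-map (_≟ i) (Fin.suc {n}) (allFin n)) ⟩
  suc (count ((_≟ i) ∘ Fin.suc {n}) (allFin n))    ≡⟨ cong suc (count-none _ (λ _ ()) (allFin n)) ⟩
  1                                                ∎
  where open ≡-Reasoning
count-≟-allFin {suc n} i@(Fin.suc j) = begin
  count (_≟ i) (allFin (suc n))                    ≡⟨ cong (count (_≟ i)) (allFin-suc n) ⟩
  count (_≟ i) (map Fin.suc (allFin n))            ≡⟨ count-map (_≟ i) (Fin.suc {n}) (allFin n) ⟩
  count ((_≟ i) ∘ Fin.suc {n}) (allFin n)          ≡⟨ count-≐ _ (_≟ j) (suc-injective , cong Fin.suc) (allFin n) ⟩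
  count (_≟ j) (allFin n)                          ≡⟨ count-≟-allFin j ⟩
  1                                                ∎
  where open ≡-Reasoning

length-allFin : ∀ n → length (allFin n) ≡ n
length-allFin n = length-tabulate id

map-lookup-allFin : ∀ {a} {A : Set a} (xs : List A) → map (lookup xs) (allFin (length xs)) ≡ xs
map-lookup-allFin xs = trans (map-tabulate id (lookup xs)) (tabulate-lookup xs)

tabulate-+ : ∀ {a} {A : Set a} m n (f : Fin (m + n) → A) →
             tabulate f ≡ tabulate (f ∘ (_↑ˡ n)) ++ tabulate (f ∘ (m ↑ʳ_))
tabulate-+ zero    n f = refl
tabulate-+ (suc m) n f = cong (f Fin.zero ∷_) (tabulate-+ m n (f ∘ Fin.suc))

map-allFin-+ : ∀ {a} {A : Set a} m n (f : Fin (m + n) → A) →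
               map f (allFin (m + n)) ≡ map (f ∘ (_↑ˡ n)) (allFin m) ++ map (f ∘ (m ↑ʳ_)) (allFin n)
map-allFin-+ m n f = begin
  map f (allFin (m + n))                                          ≡⟨ map-tabulate id f ⟩
  tabulate f                                                      ≡⟨ tabulate-+ m n f ⟩
  tabulate (f ∘ (_↑ˡ n)) ++ tabulate (f ∘ (m ↑ʳ_))
    ≡⟨ cong₂ _++_ (map-tabulate id (f ∘ (_↑ˡ n))) (map-tabulate id (f ∘ (m ↑ʳ_))) ⟨
  map (f ∘ (_↑ˡ n)) (allFin m) ++ map (f ∘ (m ↑ʳ_)) (allFin n)    ∎
  where open ≡-Reasoning

module _ {a} {A : Set a} where

  sum-map-const : ∀ c (xs : List A) → sum (map (λ _ → c) xs) ≡ length xs * c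
  sum-map-const c []       = refl
  sum-map-const c (x ∷ xs) = cong (c +_) (sum-map-const c xs)

  sum-map-*ˡ : ∀ c (f : A → ℕ) xs → sum (map (λ x → c * f x) xs) ≡ c * sum (map f xs)
  sum-map-*ˡ c f []       = sym (*-zeroʳ c)
  sum-map-*ˡ c f (x ∷ xs) =
    trans (cong (c * f x +_) (sum-map-*ˡ c f xs)) (sym (*-distribˡ-+ c (f x) _))

  product-map-const : ∀ c (xs : List A) → product (map (λ _ → c) xs) ≡ c ^ length xs
  product-map-const c []       = refl
  product-map-const c (x ∷ xs) = cong (c *_) (product-map-const c xs)

  product-map-*ˡ : ∀ c (f : A → ℕ) xs → product (map (λ x → c * f x) xs) ≡ c ^ length xs * product (map f xs)
  product-map-*ˡ c f []       = refl
  product-map-*ˡ c f (x ∷ xs) =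
    trans (cong (c * f x *_) (product-map-*ˡ c f xs)) (*-interchange c (f x) _ _)

^-distribʳ-* : ∀ a b e → (a * b) ^ e ≡ a ^ e * b ^ e
^-distribʳ-* a b zero    = refl
^-distribʳ-* a b (suc e) = trans (cong (a * b *_) (^-distribʳ-* a b e)) (*-interchange a b _ _)

↑ˡ≢↑ʳ : ∀ {m n} (i : Fin m) (j : Fin n) → i ↑ˡ n ≢ m ↑ʳ j
↑ˡ≢↑ʳ {m} {n} i j eq =
  case trans (sym (splitAt-↑ˡ m i n)) (trans (cong (splitAt m) eq) (splitAt-↑ʳ m n j)) of λ ()

endpoints : ∀ {n} → Edge n → List (Fin n)
endpoints (u , v) = u ∷ v ∷ []

count-endpoints : ∀ {n} {x : Fin n} (e : Edge n) → proj₁ e ≢ proj₂ e →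
                  count (_≟ x) (endpoints e) ≡ count (incident? x) (e ∷ [])
count-endpoints {x = x} (u , v) u≢v with u ≟ x
... | yes refl with v ≟ x
...   | yes refl = contradiction refl u≢v
...   | no _     = refl
count-endpoints {x = x} (u , v) u≢v | no _ with v ≟ x
...   | yes _ = refl
...   | no _  = refl

count-combine : ∀ {m k} {c : Fin (m * k)} (i i₀ : Fin m) (j₀ : Fin k) → combine i₀ j₀ ≡ c →
                count (λ j → combine i j ≟ c) (allFin k) ≡ count (_≟ i₀) (i ∷ [])
count-combine {k = k} i i₀ j₀ refl with i ≟ i₀
... | yes refl = trans (count-≐ _ (_≟ j₀) (combine-injectiveʳ i _ i j₀ , cong (combine i)) (allFin k))
                       (count-≟-allFin j₀)
... | no i≢i₀  = count-none _ (λ j eq → i≢i₀ (combine-injectiveˡ i j i₀ j₀ eq)) (allFin k)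

∑ : ∀ m → (Fin m → ℕ) → ℕ
∑ m f = sum (map f (allFin m))

syntax ∑ m (λ i → f) = ∑[ i < m ] f

module SemiTotalPointGraph {n : ℕ} (k : ℕ) (E : EdgeList n) where

  M : ℕ
  M = length E * k

  liftEdge : Edge n → Edge (n + M)
  liftEdge (a , b) = (a ↑ˡ M , b ↑ˡ M)

  spoke : Fin M → Fin n → Edge (n + M)
  spoke c u = (u ↑ˡ M , n ↑ʳ c)

  spokes : Edge n → Fin M → EdgeList (n + M)
  spokes e c = map (spoke c) (endpoints e)

  degree-Rk-split : ∀ w → degree (Rk k E) w ≡
    count (incident? w) (map liftEdge E) + ∑[ e < length E ] ∑[ j < k ] count (incident? w) (spokes (lookup E e) (combine e j))
  degree-Rk-split w = begin
    count (incident? w) (map liftEdge E ++ concatMap newEdges (allFin (length E)))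
      ≡⟨ count-++ (incident? w) (map liftEdge E) _ ⟩
    count (incident? w) (map liftEdge E) + count (incident? w) (concatMap newEdges (allFin (length E)))
      ≡⟨ cong (count (incident? w) (map liftEdge E) +_) (trans (count-concatMap (incident? w) newEdges (allFin (length E)))
           (cong sum (map-cong (λ e → count-concatMap (incident? w) _ (allFin k)) (allFin (length E))))) ⟩
    count (incident? w) (map liftEdge E) + (∑[ e < length E ] ∑[ j < k ] count (incident? w) (spokes (lookup E e) (combine e j))) ∎
    where
    open ≡-Reasoning
    newEdges : Fin (length E) → EdgeList (n + M)
    newEdges e = concatMap (λ j → spokes (lookup E e) (combine e j)) (allFin k)

  degree-Rk-old : All (λ e → proj₁ e ≢ proj₂ e) E → ∀ x → degree (Rk k E) (x ↑ˡ M) ≡ suc k * degree E x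
  degree-Rk-old loopless x = trans (degree-Rk-split w) (cong₂ _+_ lifted spoked)
    where
    w = x ↑ˡ M
    open ≡-Reasoning
    lifted : count (incident? w) (map liftEdge E) ≡ degree E x
    lifted = trans (count-map (incident? w) liftEdge E)
      (count-≐ _ (incident? x) (Sum.map (↑ˡ-injective M _ x) (↑ˡ-injective M _ x) ,
                                Sum.map (cong (_↑ˡ M)) (cong (_↑ˡ M))) E)
    count-spokes : ∀ e c → count (incident? w) (spokes e c) ≡ count (_≟ x) (endpoints e)
    count-spokes e c = trans (count-map (incident? w) (spoke c) (endpoints e))
      (count-≐ (incident? w ∘ spoke c) (_≟ x)
               ([ ↑ˡ-injective M _ x , (λ eq → contradiction (sym eq) (↑ˡ≢↑ʳ x c)) ]′ , inj₁ ∘ cong (_↑ˡ M))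
               (endpoints e))
    spoked : (∑[ e < length E ] ∑[ j < k ] count (incident? w) (spokes (lookup E e) (combine e j))) ≡ k * degree E x
    spoked = begin
      (∑[ e < length E ] ∑[ j < k ] count (incident? w) (spokes (lookup E e) (combine e j)))
        ≡⟨ cong sum (map-cong (λ e → cong sum (map-cong (λ j → count-spokes (lookup E e) (combine e j)) (allFin k)))
                              (allFin (length E))) ⟩
      (∑[ e < length E ] ∑[ j < k ] count (_≟ x) (endpoints (lookup E e)))
        ≡⟨ cong sum (map-cong (λ e → trans (sum-map-const _ (allFin k)) (cong (_* _) (length-allFin k))) (allFin (length E))) ⟩
      (∑[ e < length E ] (k * count (_≟ x) (endpoints (lookup E e))))
        ≡⟨ sum-map-*ˡ k _ (allFin (length E)) ⟩
      k * ∑ (length E) (count (_≟ x) ∘ endpoints ∘ lookup E)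
        ≡⟨ cong (λ l → k * sum l) (trans (map-∘ (allFin (length E))) (cong (map _) (map-lookup-allFin E))) ⟩
      k * sum (map (count (_≟ x) ∘ endpoints) E)
        ≡⟨ cong (λ l → k * sum l) (map-cong-local (All.map (λ {e} → count-endpoints e) loopless)) ⟩
      k * sum (map (λ e → count (incident? x) (e ∷ [])) E)
        ≡⟨ cong (k *_) (count-singletons (incident? x) E) ⟨
      k * degree E x ∎

  degree-Rk-new : ∀ c₀ → degree (Rk k E) (n ↑ʳ c₀) ≡ 2
  degree-Rk-new c₀ = trans (degree-Rk-split w) (cong₂ _+_ lifted spoked)
    where
    w = n ↑ʳ c₀
    i₀ = proj₁ (remQuot {length E} k c₀)
    j₀ = proj₂ (remQuot {length E} k c₀)
    open ≡-Reasoning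
    lifted : count (incident? w) (map liftEdge E) ≡ 0
    lifted = trans (count-map (incident? w) liftEdge E)
      (count-none (incident? w ∘ liftEdge) (λ e → [ ↑ˡ≢↑ʳ (proj₁ e) c₀ , ↑ˡ≢↑ʳ (proj₂ e) c₀ ]′) E)
    count-spokes : ∀ e c → count (incident? w) (spokes e c) ≡ 2 * count (_≟ c₀) (c ∷ [])
    count-spokes e c = begin
      count (incident? w) (spokes e c)              ≡⟨ count-map (incident? w) (spoke c) (endpoints e) ⟩
      count (incident? w ∘ spoke c) (endpoints e)
        ≡⟨ count-≐ (incident? w ∘ spoke c) (λ _ → c ≟ c₀)
                   ([ (λ eq → contradiction eq (↑ˡ≢↑ʳ _ c₀)) , ↑ʳ-injective n c c₀ ]′ , inj₂ ∘ cong (n ↑ʳ_))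
                   (endpoints e) ⟩
      count (λ _ → c ≟ c₀) (endpoints e)            ≡⟨ count-map (_≟ c₀) (λ _ → c) (endpoints e) ⟨
      count (_≟ c₀) (c ∷ c ∷ [])                    ≡⟨ count-++ (_≟ c₀) (c ∷ []) (c ∷ []) ⟩
      δ + δ                                         ≡⟨ cong (δ +_) (+-identityʳ δ) ⟨
      2 * δ                                         ∎
      where δ = count (_≟ c₀) (c ∷ [])
    fibre-combine : ∀ e → (∑[ j < k ] count (_≟ c₀) (combine e j ∷ [])) ≡ count (_≟ i₀) (e ∷ [])
    fibre-combine e = begin
      (∑[ j < k ] count (_≟ c₀) (combine e j ∷ []))
        ≡⟨ cong sum (map-cong (λ j → count-map (_≟ c₀) (combine e) (j ∷ [])) (allFin k)) ⟩
      (∑[ j < k ] count (λ j → combine e j ≟ c₀) (j ∷ []))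
        ≡⟨ count-singletons (λ j → combine e j ≟ c₀) (allFin k) ⟨
      count (λ j → combine e j ≟ c₀) (allFin k)
        ≡⟨ count-combine e i₀ j₀ (combine-remQuot {length E} k c₀) ⟩
      count (_≟ i₀) (e ∷ []) ∎
    spoked : (∑[ e < length E ] ∑[ j < k ] count (incident? w) (spokes (lookup E e) (combine e j))) ≡ 2
    spoked = begin
      (∑[ e < length E ] ∑[ j < k ] count (incident? w) (spokes (lookup E e) (combine e j)))
        ≡⟨ cong sum (map-cong (λ e → cong sum (map-cong (λ j → count-spokes (lookup E e) (combine e j)) (allFin k)))
                              (allFin (length E))) ⟩
      (∑[ e < length E ] ∑[ j < k ] (2 * count (_≟ c₀) (combine e j ∷ [])))
        ≡⟨ cong sum (map-cong (λ e → sum-map-*ˡ 2 _ (allFin k)) (allFin (length E))) ⟩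
      (∑[ e < length E ] (2 * ∑[ j < k ] count (_≟ c₀) (combine e j ∷ [])))
        ≡⟨ sum-map-*ˡ 2 _ (allFin (length E)) ⟩
      2 * (∑[ e < length E ] ∑[ j < k ] count (_≟ c₀) (combine e j ∷ []))
        ≡⟨ cong (λ l → 2 * sum l) (map-cong fibre-combine (allFin (length E))) ⟩
      2 * (∑[ e < length E ] count (_≟ i₀) (e ∷ []))
        ≡⟨ cong (2 *_) (count-singletons (_≟ i₀) (allFin (length E))) ⟨
      2 * count (_≟ i₀) (allFin (length E))
        ≡⟨ cong (2 *_) (count-≟-allFin i₀) ⟩
      2 ∎

  Π₁-Rk : All (λ e → proj₁ e ≢ proj₂ e) E → Π₁ (Rk k E) ≡ 4 ^ M * suc k ^ (2 * n) * Π₁ E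
  Π₁-Rk loopless = begin
    product (map D (allFin (n + M)))
      ≡⟨ cong product (map-allFin-+ n M D) ⟩
    product (map (D ∘ (_↑ˡ M)) (allFin n) ++ map (D ∘ (n ↑ʳ_)) (allFin M))
      ≡⟨ product-++ (map (D ∘ (_↑ˡ M)) (allFin n)) _ ⟩
    product (map (D ∘ (_↑ˡ M)) (allFin n)) * product (map (D ∘ (n ↑ʳ_)) (allFin M))
      ≡⟨ cong₂ (λ l l′ → product l * product l′) (map-cong D-old (allFin n)) (map-cong D-new (allFin M)) ⟩
    product (map (λ x → suc k ^ 2 * degree E x ^ 2) (allFin n)) * product (map (λ _ → 4) (allFin M))
      ≡⟨ cong₂ _*_ (product-map-*ˡ (suc k ^ 2) _ (allFin n)) (product-map-const 4 (allFin M)) ⟩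
    (suc k ^ 2) ^ length (allFin n) * Π₁ E * 4 ^ length (allFin M)
      ≡⟨ cong₂ (λ a b → a * Π₁ E * 4 ^ b) (trans (cong ((suc k ^ 2) ^_) (length-allFin n)) (^-*-assoc (suc k) 2 n))
                                        (length-allFin M) ⟩
    suc k ^ (2 * n) * Π₁ E * 4 ^ M
      ≡⟨ *-comm (suc k ^ (2 * n) * Π₁ E) (4 ^ M) ⟩
    4 ^ M * (suc k ^ (2 * n) * Π₁ E)
      ≡⟨ *-assoc (4 ^ M) _ _ ⟨
    4 ^ M * suc k ^ (2 * n) * Π₁ E ∎
    where
    open ≡-Reasoning
    D : Fin (n + M) → ℕ
    D v = degree (Rk k E) v ^ 2
    D-old : ∀ x → D (x ↑ˡ M) ≡ suc k ^ 2 * degree E x ^ 2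
    D-old x = trans (cong (_^ 2) (degree-Rk-old loopless x)) (^-distribʳ-* (suc k) (degree E x) 2)
    D-new : ∀ c → D (n ↑ʳ c) ≡ 4
    D-new c = cong (_^ 2) (degree-Rk-new c)

open SemiTotalPointGraph using (Π₁-Rk)

theorem2p11 : (n : ℕ) (E : EdgeList n) → IsSimple E → IsConnected E →
    (k : ℕ) → k ≥ 1 →
    Π₁ (Rk k E) ≡ 4 ^ (k * length E) * (k + 1) ^ (2 * n) * Π₁ E
theorem2p11 n E (loopless , _) _ k _ = begin
  Π₁ (Rk k E)                                      ≡⟨ Π₁-Rk k E loopless ⟩
  4 ^ (length E * k) * suc k ^ (2 * n) * Π₁ E
    ≡⟨ cong₂ (λ a b → 4 ^ a * b ^ (2 * n) * Π₁ E) (*-comm (length E) k) (+-comm 1 k) ⟩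
  4 ^ (k * length E) * (k + 1) ^ (2 * n) * Π₁ E    ∎
  where open ≡-Reasoning
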